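{- Let $n$ be even and let $X = \mathrm{Cay}(\mathbb{Z}_n, S)$ be a circulant graph. If $X$ has Wilson type (C.1), (C.2$'$), or (C.3$'$), then there are nontrivial subgroups $H$ and $K$ of $\mathbb{Z}_n$ with $|K|$ even such that, letting $K_o = K \setminus 2K$, we have $(S \setminus K_o) + H \subseteq S \cup K_o$, and either $|H| \neq 2$ or $|K|$ is divisible by $4$.
   Context: All graphs are finite, simple and undirected. For an abelian group $G$ and $S \subseteq G$ with $-S = S$, $0 \notin S$, $\mathrm{Cay}(G,S)$ has vertex set $G$ with $v \sim w$ iff $w - v \in S$. For $n$ even and $S \subseteq \mathbb{Z}_n$, let $S_e = S \cap 2\mathbb{Z}_n$ and $S_o = S \setminus S_e$. The circulant graph $\mathrm{Cay}(\mathbb{Z}_n,S)$ has Wilson type: (C.1) if there is a nonzero $h \in 2\mathbb{Z}_n$ with $h + S_e = S_e$; (C.2$'$) if $4 \mid n$ and there exists $h \in 1 + 2\mathbb{Z}_n$ such that $2h + S_o = S_o$, and for each $s \in S$ with $s \equiv 0$ or $s \equiv -h \pmod 4$ we have $s + h \in S$; (C.3$'$) if there is a subgroup $H$ of $\mathbb{Z}_n$ such that the set $R = \{ s \in S : s + H \not\subseteq S\}$ is nonempty and, letting $d = \gcd(R \cup \{n\})$ (elements of $\mathbb{Z}_n$ regarded as integers in $\{0,\dots,n-1\}$), $n/d$ is even, $r/d$ is odd for every $r \in R$, and either $H \not\subseteq d\mathbb{Z}_n$ or $H \subseteq 2d\mathbb{Z}_n$; (C.4) if there exists $m \in \mathbb{Z}_n^\times$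 with $(n/2) + mS = S$. For a subgroup $K$, $2K = \{2k : k \in K\}$. -}

module Defs where

open import Data.Nat using (ℕ; zero; suc; _*_; NonZero)
import Data.Nat as N
open import Data.Nat.DivMod using (_mod_)
open import Data.Nat.Divisibility using (_∣_)
open import Data.Fin using (Fin; toℕ)
open import Data.Fin.Subset using (Subset; _∈_; _∉_; ∣_∣)
open import Data.Product using (Σ; ∃; ∃-syntax; _×_; _,_)
open import Data.Sum using (_⊎_)
open import Relation.Nullary using (¬_)
open import Relation.Binary.PropositionalEquality using (_≡_; _≢_)

-- The cyclic group ℤ_n, elements represented by Fin n (representatives 0..n-1).
module _ (n : ℕ) .{{_ : NonZero n}} where

  𝟘 : Fin n
  𝟘 = 0 mod n

  _⊕_ : Fin n → Fin n → Fin n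
  x ⊕ y = (toℕ x N.+ toℕ y) mod n

  ⊖ : Fin n → Fin n
  ⊖ x = (n N.∸ toℕ x) mod n

  -- x ∈ 2ℤ_n (n is assumed even, so parity of the representative is well defined)
  IsEven : Fin n → Set
  IsEven x = 2 ∣ toℕ x

  ConnectionSet : Subset n → Set
  ConnectionSet S = (∀ x → x ∈ S → ⊖ x ∈ S) × 𝟘 ∉ S

  IsSubgroup : Subset n → Set
  IsSubgroup H = 𝟘 ∈ H × (∀ x y → x ∈ H → y ∈ H → (x ⊕ y) ∈ H)
                       × (∀ x → x ∈ H → ⊖ x ∈ H)

  Nontrivial : Subset n → Set
  Nontrivial H = ∃[ x ] (x ∈ H × x ≢ 𝟘)

  InSe : Subset n → Fin n → Set
  InSe S x = x ∈ S × IsEven x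

  InSo : Subset n → Fin n → Set
  InSo S x = x ∈ S × ¬ IsEven x

  TranslateEq : Fin n → (Fin n → Set) → Set
  TranslateEq g A = ∀ t → (A t → ∃[ s ] (A s × t ≡ (g ⊕ s)))
                        × (∃[ s ] (A s × t ≡ (g ⊕ s)) → A t)

  WilsonC1 : Subset n → Set
  WilsonC1 S = ∃[ h ] (h ≢ 𝟘 × IsEven h × TranslateEq h (InSe S))

  WilsonC2' : Subset n → Set
  WilsonC2' S = (4 ∣ n) × ∃[ h ] (¬ IsEven h × TranslateEq (h ⊕ h) (InSo S)
      × (∀ s → s ∈ S → ((4 ∣ toℕ s) ⊎ (4 ∣ (toℕ s N.+ toℕ h))) → (s ⊕ h) ∈ S))

  InR : Subset n → Subset n → Fin n → Set
  InR S H s = s ∈ S × ¬ (∀ x → x ∈ H → (s ⊕ x) ∈ S)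

  -- d = gcd(R ∪ {n}), stated via the defining (universal) property of the gcd
  IsGcdRn : Subset n → Subset n → ℕ → Set
  IsGcdRn S H d = ((d ∣ n) × (∀ r → InR S H r → d ∣ toℕ r))
    × (∀ c → (c ∣ n) → (∀ r → InR S H r → c ∣ toℕ r) → c ∣ d)

  WilsonC3' : Subset n → Set
  WilsonC3' S = ∃[ H ] (IsSubgroup H × ∃[ r₀ ] InR S H r₀ × ∃[ d ] (IsGcdRn S H d
      × ∃[ q ] (n ≡ q * d × (2 ∣ q))
      × (∀ r → InR S H r → ∃[ q ] (toℕ r ≡ q * d × ¬ (2 ∣ q)))
      × (¬ (∀ x → x ∈ H → d ∣ toℕ x) ⊎ (∀ x → x ∈ H → (2 * d) ∣ toℕ x))))

  InKo : Subset n → Fin n → Set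
  InKo K x = x ∈ K × ¬ (∃[ k ] (k ∈ K × x ≡ (k ⊕ k)))

  Conclusion : Subset n → Set
  Conclusion S = ∃[ H ] ∃[ K ] (IsSubgroup H × Nontrivial H
      × IsSubgroup K × Nontrivial K × (2 ∣ (∣ K ∣))
      × (∀ s h → s ∈ S → ¬ InKo K s → h ∈ H → ((s ⊕ h) ∈ S ⊎ InKo K (s ⊕ h)))
      × ((∣ H ∣) ≢ 2 ⊎ (4 ∣ (∣ K ∣))))

{-# OPTIONS --safe #-}
module Submission where

-- In every case K is dℤ_n for a divisor d with n/d even (d = 1 for (C.1), d = 2 for (C.2'), the
-- given d for (C.3')), so that K_o = K ∖ 2K is the set of odd multiples of d; H is the cyclic
-- subgroup ⟨h⟩ in (C.1) and (C.2') and the given H in (C.3'). In (C.1), S ∖ K_o = S_e is invariant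
-- under h. In (C.3'), an s ∈ S with s + H ⊈ S lies in R and so is an odd multiple of d. In (C.2'),
-- walking from s ∈ S ∖ K_o along s + h, s + 2h, …, each step either stays in S ∖ K_o, or passes
-- one element ≡ 2 (mod 4) of K_o and is brought back into S ∖ K_o by 2h + S_o = S_o. Finally
-- |H| = 2 forces H = {0, n/2}: the parity of h rules this out in (C.2'), and in (C.1) and (C.3')
-- it forces 4 ∣ n/d.

open import Defs hiding (𝟘; _⊕_; ⊖)
import Defs
open import Data.Bool using (Bool; true; false)
open import Data.Fin using (Fin; zero; suc; toℕ; _≟_)
open import Data.Fin.Properties using (toℕ-injective; toℕ<n; toℕ-fromℕ<; any?; ¬∀⟶∃¬)
open import Data.Fin.Subset using (Subset; _∈_; _⊆_; _⊂_; _∪_; ⁅_⁆; ∣_∣)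
open import Data.Fin.Subset.Properties
  using (_∈?_; x∈⁅x⁆; x∈⁅y⁆⇒x≡y; p⊆p∪q; x∈p∪q⁺; x∈p∪q⁻; ∣⁅x⁆∣≡1; p⊆q⇒∣p∣≤∣q∣; p⊂q⇒∣p∣<∣q∣)
open import Data.Nat using (ℕ; zero; suc; _+_; _*_; _∸_; _<_; _≤_; z≤n; s≤s; NonZero; ≢-nonZero⁻¹)
open import Data.Nat.DivMod
open import Data.Nat.Divisibility
open import Data.Nat.Properties hiding (_≟_)
open import Data.Product using (∃-syntax; Σ-syntax; _×_; _,_; proj₁; proj₂)
open import Data.Sum using (_⊎_; inj₁; inj₂; [_,_]; map₂)
open import Data.Vec using (tabulate)
open import Data.Vec.Properties using (tabulate-cong; []=⇒lookup; lookup⇒[]=; lookup∘tabulate)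
open import Function using (_∘_; mk⇔)
open import Relation.Binary.PropositionalEquality hiding ([_])
open import Relation.Nullary using (¬_; Dec; yes; no; does; contradiction; _→-dec_)
open import Relation.Nullary.Decidable using (dec-true; dec-false; does-⇔)
open import Relation.Unary using (Pred; Decidable)

subset : ∀ {m p} {P : Pred (Fin m) p} → Decidable P → Subset m
subset P? = tabulate (does ∘ P?)

module _ {m p} {P : Pred (Fin m) p} (P? : Decidable P) where

  ∈-subset⁺ : ∀ {x} → P x → x ∈ subset P?
  ∈-subset⁺ {x} px = lookup⇒[]= x _ (trans (lookup∘tabulate _ x) (dec-true (P? x) px))

  ∈-subset⁻ : ∀ {x} → x ∈ subset P? → P x
  ∈-subset⁻ {x} x∈ with P? x | trans (sym (lookup∘tabulate (does ∘ P?) x)) ([]=⇒lookup x∈)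
  ... | yes px | _ = px
  ... | no _   | ()

3≤∣p∣ : ∀ {m} {p : Subset m} {x y z} → x ∈ p → y ∈ p → z ∈ p → x ≢ y → x ≢ z → y ≢ z → 3 ≤ ∣ p ∣
3≤∣p∣ {p = p} {x} {y} {z} x∈p y∈p z∈p x≢y x≢z y≢z = begin-strict
    2                ≡⟨ cong suc (sym (∣⁅x⁆∣≡1 x)) ⟩
    suc ∣ ⁅ x ⁆ ∣    ≤⟨ p⊂q⇒∣p∣<∣q∣ ⁅x⁆⊂xy ⟩
    ∣ xy ∣           <⟨ p⊂q⇒∣p∣<∣q∣ xy⊂xyz ⟩
    ∣ xy ∪ ⁅ z ⁆ ∣   ≤⟨ p⊆q⇒∣p∣≤∣q∣ xyz⊆p ⟩
    ∣ p ∣            ∎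
  where
  open ≤-Reasoning
  xy = ⁅ x ⁆ ∪ ⁅ y ⁆
  ⁅x⁆⊂xy : ⁅ x ⁆ ⊂ xy
  ⁅x⁆⊂xy = p⊆p∪q ⁅ y ⁆ , y , x∈p∪q⁺ (inj₂ (x∈⁅x⁆ y)) , λ y∈⁅x⁆ → x≢y (sym (x∈⁅y⁆⇒x≡y x y∈⁅x⁆))
  xy⊂xyz : xy ⊂ xy ∪ ⁅ z ⁆
  xy⊂xyz = p⊆p∪q ⁅ z ⁆ , z , x∈p∪q⁺ (inj₂ (x∈⁅x⁆ z)) ,
      [ (λ z∈⁅x⁆ → x≢z (sym (x∈⁅y⁆⇒x≡y x z∈⁅x⁆))) , (λ z∈⁅y⁆ → y≢z (sym (x∈⁅y⁆⇒x≡y y z∈⁅y⁆))) ]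
    ∘ x∈p∪q⁻ ⁅ x ⁆ ⁅ y ⁆
  ∈p : ∀ {u} w → w ∈ p → u ∈ ⁅ w ⁆ → u ∈ p
  ∈p w w∈p u∈⁅w⁆ = subst (_∈ p) (sym (x∈⁅y⁆⇒x≡y w u∈⁅w⁆)) w∈p
  xyz⊆p : xy ∪ ⁅ z ⁆ ⊆ p
  xyz⊆p = [ [ ∈p x x∈p , ∈p y y∈p ] ∘ x∈p∪q⁻ ⁅ x ⁆ ⁅ y ⁆ , ∈p z z∈p ] ∘ x∈p∪q⁻ xy ⁅ z ⁆

∣p∣≡2⇒≡⊎≡ : ∀ {m} {p : Subset m} {x y z} → ∣ p ∣ ≡ 2 → x ∈ p → y ∈ p → x ≢ y → z ∈ p → z ≡ x ⊎ z ≡ y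
∣p∣≡2⇒≡⊎≡ {x = x} {y} {z} ∣p∣≡2 x∈p y∈p x≢y z∈p with z ≟ x | z ≟ y
... | yes z≡x | _       = inj₁ z≡x
... | no _    | yes z≡y = inj₂ z≡y
... | no z≢x  | no z≢y  =
  contradiction (subst (3 ≤_) ∣p∣≡2 (3≤∣p∣ x∈p y∈p z∈p x≢y (z≢x ∘ sym) (z≢y ∘ sym))) (n≮n 2)

[m%d+n]%d≡[m+n]%d : ∀ m n d .{{_ : NonZero d}} → (m % d + n) % d ≡ (m + n) % d
[m%d+n]%d≡[m+n]%d m n d = begin
  (m % d + n) % d          ≡⟨ %-distribˡ-+ (m % d) n d ⟩
  (m % d % d + n % d) % d  ≡⟨ cong (λ k → (k + n % d) % d) (m%n%n≡m%n m d) ⟩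
  (m % d + n % d) % d      ≡⟨ %-distribˡ-+ m n d ⟨
  (m + n) % d              ∎
  where open ≡-Reasoning

[m+n%d]%d≡[m+n]%d : ∀ m n d .{{_ : NonZero d}} → (m + n % d) % d ≡ (m + n) % d
[m+n%d]%d≡[m+n]%d m n d = begin
  (m + n % d) % d  ≡⟨ cong (_% d) (+-comm m (n % d)) ⟩
  (n % d + m) % d  ≡⟨ [m%d+n]%d≡[m+n]%d n m d ⟩
  (n + m) % d      ≡⟨ cong (_% d) (+-comm n m) ⟩
  (m + n) % d      ∎
  where open ≡-Reasoning

[m%d*n]%d≡[m*n]%d : ∀ m n d .{{_ : NonZero d}} → (m % d * n) % d ≡ (m * n) % d
[m%d*n]%d≡[m*n]%d m n d = begin
  (m % d * n) % d            ≡⟨ %-distribˡ-* (m % d) n d ⟩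
  (m % d % d * (n % d)) % d  ≡⟨ cong (λ k → (k * (n % d)) % d) (m%n%n≡m%n m d) ⟩
  (m % d * (n % d)) % d      ≡⟨ %-distribˡ-* m n d ⟨
  (m * n) % d                ∎
  where open ≡-Reasoning

∣-double⁺ : ∀ {c a} → c ∣ a → 2 * c ∣ a + a
∣-double⁺ {c} {a} c∣a = subst (2 * c ∣_) (cong (a +_) (+-identityʳ a)) (*-monoʳ-∣ 2 c∣a)

∣-double⁻ : ∀ {c a} → 2 * c ∣ a + a → c ∣ a
∣-double⁻ {c} {a} 2c∣a+a = *-cancelˡ-∣ 2 (subst (2 * c ∣_) (cong (a +_) (sym (+-identityʳ a))) 2c∣a+a)

¬2∣⇒%2≡1 : ∀ {a} → ¬ 2 ∣ a → a % 2 ≡ 1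
¬2∣⇒%2≡1 {a} ¬2∣a with a % 2 in eq | m%n<n a 2
... | 0 | _ = contradiction (m%n≡0⇒n∣m a 2 eq) ¬2∣a
... | 1 | _ = refl
... | suc (suc _) | s≤s (s≤s ())

odd+odd⇒even : ∀ {a b} → ¬ 2 ∣ a → ¬ 2 ∣ b → 2 ∣ a + b
odd+odd⇒even {a} {b} ¬2∣a ¬2∣b = m%n≡0⇒n∣m (a + b) 2 (begin
  (a + b) % 2            ≡⟨ %-distribˡ-+ a b 2 ⟩
  (a % 2 + b % 2) % 2    ≡⟨ cong₂ (λ i j → (i + j) % 2) (¬2∣⇒%2≡1 ¬2∣a) (¬2∣⇒%2≡1 ¬2∣b) ⟩
  0                      ∎)
  where open ≡-Reasoning

OddMultiple : ℕ → ℕ → Set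
OddMultiple d t = d ∣ t × ¬ (2 * d ∣ t)

divides-toℕ? : ∀ {m} d (x : Fin m) → Dec (d ∣ toℕ x)
divides-toℕ? d x = d ∣? toℕ x

multiples : ∀ {m} → ℕ → Subset m
multiples d = subset (divides-toℕ? d)

∈-multiples⁺ : ∀ {m d} {x : Fin m} → d ∣ toℕ x → x ∈ multiples d
∈-multiples⁺ {d = d} = ∈-subset⁺ (divides-toℕ? d)

∈-multiples⁻ : ∀ {m d} {x : Fin m} → x ∈ multiples d → d ∣ toℕ x
∈-multiples⁻ {d = d} = ∈-subset⁻ (divides-toℕ? d)

∣tabulate∣-+ : ∀ m k (f : ℕ → Bool) →
  ∣ tabulate {n = m + k} (f ∘ toℕ) ∣ ≡ ∣ tabulate {n = m} (f ∘ toℕ) ∣ + ∣ tabulate {n = k} (f ∘ (m +_) ∘ toℕ) ∣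
∣tabulate∣-+ zero    k f = refl
∣tabulate∣-+ (suc m) k f with f 0 | ∣tabulate∣-+ m k (f ∘ suc)
... | true  | ih = cong suc ih
... | false | ih = ih

∣tabulate-false∣ : ∀ m (f : Fin m → Bool) → (∀ i → f i ≡ false) → ∣ tabulate f ∣ ≡ 0
∣tabulate-false∣ zero    f _       = refl
∣tabulate-false∣ (suc m) f f≡false rewrite f≡false zero =
  ∣tabulate-false∣ m (f ∘ suc) (f≡false ∘ suc)

∣multiples∣ : ∀ d .{{_ : NonZero d}} q {m} → m ≡ q * d → ∣ multiples {m} d ∣ ≡ q
∣multiples∣ d@(suc d-1) q refl = count q
  where
  f : ℕ → Bool
  f i = does (d ∣? i)
  f-shift : ∀ i → f (d + i) ≡ f i
  f-shift i = does-⇔ (mk⇔ (λ d∣d+i → ∣m+n∣m⇒∣n d∣d+i ∣-refl) (∣m∣n⇒∣m+n ∣-refl)) (d ∣? d + i) (d ∣? i)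
  first-block : ∣ tabulate {n = d} (f ∘ toℕ) ∣ ≡ 1
  first-block rewrite dec-true (d ∣? 0) (d ∣0) =
    cong suc (∣tabulate-false∣ d-1 _ λ i → dec-false (d ∣? suc (toℕ i)) λ d∣ → <⇒≱ (s≤s (toℕ<n i)) (∣⇒≤ d∣))
  count : ∀ q → ∣ tabulate {n = q * d} (f ∘ toℕ) ∣ ≡ q
  count zero    = refl
  count (suc q) = begin
    ∣ tabulate {n = d + q * d} (f ∘ toℕ) ∣
      ≡⟨ ∣tabulate∣-+ d (q * d) f ⟩
    ∣ tabulate {n = d} (f ∘ toℕ) ∣ + ∣ tabulate {n = q * d} (f ∘ (d +_) ∘ toℕ) ∣
      ≡⟨ cong₂ _+_ first-block (cong (∣_∣ {n = q * d}) (tabulate-cong (f-shift ∘ toℕ))) ⟩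
    suc ∣ tabulate {n = q * d} (f ∘ toℕ) ∣
      ≡⟨ cong suc (count q) ⟩
    suc q ∎
    where open ≡-Reasoning

module _ (n : ℕ) .{{_ : NonZero n}} where

  𝟘 : Fin n
  𝟘 = Defs.𝟘 n

  infixl 6 _⊕_
  _⊕_ : Fin n → Fin n → Fin n
  _⊕_ = Defs._⊕_ n

  ⊖ : Fin n → Fin n
  ⊖ = Defs.⊖ n

  toℕ-mod : ∀ a → toℕ (a mod n) ≡ a % n
  toℕ-mod a = toℕ-fromℕ< (m%n<n a n)

  mod-cong : ∀ {a b} → a % n ≡ b % n → a mod n ≡ b mod n
  mod-cong {a} {b} eq = toℕ-injective (trans (toℕ-mod a) (trans eq (sym (toℕ-mod b))))

  mod-toℕ : ∀ x → toℕ x mod n ≡ x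
  mod-toℕ x = toℕ-injective (trans (toℕ-mod (toℕ x)) (m<n⇒m%n≡m (toℕ<n x)))

  toℕ-𝟘 : toℕ 𝟘 ≡ 0
  toℕ-𝟘 = trans (toℕ-mod 0) (m*n%n≡0 0 n)

  toℕ-⊕ : ∀ x y → toℕ (x ⊕ y) ≡ (toℕ x + toℕ y) % n
  toℕ-⊕ x y = toℕ-mod (toℕ x + toℕ y)

  ⊕-comm : ∀ x y → x ⊕ y ≡ y ⊕ x
  ⊕-comm x y = cong (_mod n) (+-comm (toℕ x) (toℕ y))

  ⊕-assoc : ∀ x y z → (x ⊕ y) ⊕ z ≡ x ⊕ (y ⊕ z)
  ⊕-assoc x y z = mod-cong (begin
    (toℕ (x ⊕ y) + toℕ z) % n         ≡⟨ cong (λ k → (k + toℕ z) % n) (toℕ-⊕ x y) ⟩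
    ((toℕ x + toℕ y) % n + toℕ z) % n  ≡⟨ [m%d+n]%d≡[m+n]%d (toℕ x + toℕ y) (toℕ z) n ⟩
    (toℕ x + toℕ y + toℕ z) % n        ≡⟨ cong (_% n) (+-assoc (toℕ x) (toℕ y) (toℕ z)) ⟩
    (toℕ x + (toℕ y + toℕ z)) % n      ≡⟨ [m+n%d]%d≡[m+n]%d (toℕ x) (toℕ y + toℕ z) n ⟨
    (toℕ x + (toℕ y + toℕ z) % n) % n  ≡⟨ cong (λ k → (toℕ x + k) % n) (toℕ-⊕ y z) ⟨
    (toℕ x + toℕ (y ⊕ z)) % n         ∎)
    where open ≡-Reasoning

  ⊕-identityˡ : ∀ x → 𝟘 ⊕ x ≡ x
  ⊕-identityˡ x = trans (cong (λ k → (k + toℕ x) mod n) toℕ-𝟘) (mod-toℕ x)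

  ⊕-identityʳ : ∀ x → x ⊕ 𝟘 ≡ x
  ⊕-identityʳ x = trans (⊕-comm x 𝟘) (⊕-identityˡ x)

  ⊖-inverseˡ : ∀ x → ⊖ x ⊕ x ≡ 𝟘
  ⊖-inverseˡ x = mod-cong (begin
    (toℕ (⊖ x) + toℕ x) % n           ≡⟨ cong (λ k → (k + toℕ x) % n) (toℕ-mod (n ∸ toℕ x)) ⟩
    ((n ∸ toℕ x) % n + toℕ x) % n      ≡⟨ [m%d+n]%d≡[m+n]%d (n ∸ toℕ x) (toℕ x) n ⟩
    (n ∸ toℕ x + toℕ x) % n            ≡⟨ cong (_% n) (m∸n+n≡m (<⇒≤ (toℕ<n x))) ⟩
    n % n                              ≡⟨ trans (n%n≡0 n) (sym (m*n%n≡0 0 n)) ⟩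
    0 % n                              ∎)
    where open ≡-Reasoning

  ⊖-inverseʳ : ∀ x → x ⊕ ⊖ x ≡ 𝟘
  ⊖-inverseʳ x = trans (⊕-comm x (⊖ x)) (⊖-inverseˡ x)

  ⊕-cancelʳ : ∀ x y z → y ⊕ x ≡ z ⊕ x → y ≡ z
  ⊕-cancelʳ x y z y+x≡z+x = begin
    y                ≡⟨ ⊕-identityʳ y ⟨
    y ⊕ 𝟘            ≡⟨ cong (y ⊕_) (⊖-inverseʳ x) ⟨
    y ⊕ (x ⊕ ⊖ x)    ≡⟨ ⊕-assoc y x (⊖ x) ⟨
    (y ⊕ x) ⊕ ⊖ x    ≡⟨ cong (_⊕ ⊖ x) y+x≡z+x ⟩
    (z ⊕ x) ⊕ ⊖ x    ≡⟨ ⊕-assoc z x (⊖ x) ⟩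
    z ⊕ (x ⊕ ⊖ x)    ≡⟨ cong (z ⊕_) (⊖-inverseʳ x) ⟩
    z ⊕ 𝟘            ≡⟨ ⊕-identityʳ z ⟩
    z                ∎
    where open ≡-Reasoning

  ⊖-unique : ∀ {x y} → y ⊕ x ≡ 𝟘 → y ≡ ⊖ x
  ⊖-unique {x} {y} y⊕x≡𝟘 = ⊕-cancelʳ x y (⊖ x) (trans y⊕x≡𝟘 (sym (⊖-inverseˡ x)))

  x⊕x≢x : ∀ {x} → x ≢ 𝟘 → x ⊕ x ≢ x
  x⊕x≢x {x} x≢𝟘 x⊕x≡x = x≢𝟘 (⊕-cancelʳ x x 𝟘 (trans x⊕x≡x (sym (⊕-identityˡ x))))

  ∣toℕ-mod⁺ : ∀ {c a} → c ∣ n → c ∣ a → c ∣ toℕ (a mod n)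
  ∣toℕ-mod⁺ {c} {a} c∣n c∣a = subst (c ∣_) (sym (toℕ-mod a)) (%-presˡ-∣ c∣a c∣n)

  ∣toℕ-𝟘 : ∀ c → c ∣ toℕ 𝟘
  ∣toℕ-𝟘 c = subst (c ∣_) (sym toℕ-𝟘) (c ∣0)

  ¬∣toℕ⇒≢𝟘 : ∀ {c x} → ¬ c ∣ toℕ x → x ≢ 𝟘
  ¬∣toℕ⇒≢𝟘 {c} ¬c∣x refl = ¬c∣x (∣toℕ-𝟘 c)

  ∣toℕ-mod⁻ : ∀ {c a} → c ∣ n → c ∣ toℕ (a mod n) → c ∣ a
  ∣toℕ-mod⁻ {c} {a} c∣n c∣a%n = ∣n∣m%n⇒∣m c∣n (subst (c ∣_) (toℕ-mod a) c∣a%n)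

  x⊕x≡𝟘⇒x+x≡n : ∀ {x} → x ≢ 𝟘 → x ⊕ x ≡ 𝟘 → toℕ x + toℕ x ≡ n
  x⊕x≡𝟘⇒x+x≡n {x} x≢𝟘 x⊕x≡𝟘 with ∣toℕ-mod⁻ ∣-refl (subst (λ y → n ∣ toℕ y) (sym x⊕x≡𝟘) (∣toℕ-𝟘 n))
  ... | divides zero          x+x≡0 =
    contradiction (toℕ-injective (trans (m+n≡0⇒m≡0 (toℕ x) x+x≡0) (sym toℕ-𝟘))) x≢𝟘
  ... | divides 1             x+x≡n = trans x+x≡n (+-identityʳ n)
  ... | divides (suc (suc k)) x+x≡k =
    contradiction (subst (n + n ≤_) (sym x+x≡k) (+-monoʳ-≤ n (m≤m+n n (k * n))))
                  (<⇒≱ (+-mono-< (toℕ<n x) (toℕ<n x)))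

  infixr 7 _·_
  _·_ : ℕ → Fin n → Fin n
  zero  · g = 𝟘
  suc k · g = g ⊕ k · g

  toℕ-· : ∀ k g → toℕ (k · g) ≡ (k * toℕ g) % n
  toℕ-· zero    g = toℕ-mod 0
  toℕ-· (suc k) g = begin
    toℕ (g ⊕ k · g)                ≡⟨ toℕ-⊕ g (k · g) ⟩
    (toℕ g + toℕ (k · g)) % n      ≡⟨ cong (λ i → (toℕ g + i) % n) (toℕ-· k g) ⟩
    (toℕ g + k * toℕ g % n) % n    ≡⟨ [m+n%d]%d≡[m+n]%d (toℕ g) (k * toℕ g) n ⟩
    (toℕ g + k * toℕ g) % n        ∎
    where open ≡-Reasoning

  ·-mod : ∀ k g → k · g ≡ (k % n) · g
  ·-mod k g = toℕ-injective (begin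
    toℕ (k · g)              ≡⟨ toℕ-· k g ⟩
    (k * toℕ g) % n          ≡⟨ [m%d*n]%d≡[m*n]%d k (toℕ g) n ⟨
    (k % n * toℕ g) % n      ≡⟨ toℕ-· (k % n) g ⟨
    toℕ ((k % n) · g)        ∎)
    where open ≡-Reasoning

  ·-distribʳ-+ : ∀ a b g → (a + b) · g ≡ a · g ⊕ b · g
  ·-distribʳ-+ zero    b g = sym (⊕-identityˡ (b · g))
  ·-distribʳ-+ (suc a) b g = trans (cong (g ⊕_) (·-distribʳ-+ a b g)) (sym (⊕-assoc g (a · g) (b · g)))

  n·g≡𝟘 : ∀ g → n · g ≡ 𝟘
  n·g≡𝟘 g = toℕ-injective (begin
    toℕ (n · g)      ≡⟨ toℕ-· n g ⟩
    (n * toℕ g) % n  ≡⟨ cong (_% n) (*-comm n (toℕ g)) ⟩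
    (toℕ g * n) % n  ≡⟨ m*n%n≡0 (toℕ g) n ⟩
    0                ≡⟨ toℕ-𝟘 ⟨
    toℕ 𝟘            ∎)
    where open ≡-Reasoning

  ⊕-·-suc : ∀ s k g → s ⊕ suc k · g ≡ (s ⊕ g) ⊕ k · g
  ⊕-·-suc s k g = sym (⊕-assoc s g (k · g))

  ·-closed : ∀ {p} (P : Pred (Fin n) p) {g} → (∀ s → P s → P (s ⊕ g)) → ∀ k {s} → P s → P (s ⊕ k · g)
  ·-closed P step zero    {s} Ps = subst P (sym (⊕-identityʳ s)) Ps
  ·-closed P step (suc k) {s} Ps = subst P (sym (⊕-·-suc s k _)) (·-closed P step k (step s Ps))

  multiple? : ∀ g x → Dec (Σ[ j ∈ Fin n ] x ≡ toℕ j · g)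
  multiple? g x = any? (λ j → x ≟ toℕ j · g)

  ⟨_⟩ : Fin n → Subset n
  ⟨ g ⟩ = subset (multiple? g)

  ·∈⟨⟩ : ∀ k g → k · g ∈ ⟨ g ⟩
  ·∈⟨⟩ k g = ∈-subset⁺ (multiple? g) (k mod n , trans (·-mod k g) (cong (_· g) (sym (toℕ-mod k))))

  g∈⟨g⟩ : ∀ g → g ∈ ⟨ g ⟩
  g∈⟨g⟩ g = subst (_∈ ⟨ g ⟩) (⊕-identityʳ g) (·∈⟨⟩ 1 g)

  ∈⟨⟩⁻ : ∀ {g x} → x ∈ ⟨ g ⟩ → Σ[ j ∈ Fin n ] x ≡ toℕ j · g
  ∈⟨⟩⁻ {g} = ∈-subset⁻ (multiple? g)

  ⟨⟩-isSubgroup : ∀ g → IsSubgroup n ⟨ g ⟩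
  ⟨⟩-isSubgroup g = ·∈⟨⟩ 0 g , ⊕-closed , ⊖-closed
    where
    ⊕-closed : ∀ x y → x ∈ ⟨ g ⟩ → y ∈ ⟨ g ⟩ → x ⊕ y ∈ ⟨ g ⟩
    ⊕-closed x y x∈ y∈ with ∈⟨⟩⁻ x∈ | ∈⟨⟩⁻ y∈
    ... | i , refl | j , refl = subst (_∈ ⟨ g ⟩) (·-distribʳ-+ (toℕ i) (toℕ j) g) (·∈⟨⟩ (toℕ i + toℕ j) g)
    ⊖-closed : ∀ x → x ∈ ⟨ g ⟩ → ⊖ x ∈ ⟨ g ⟩
    ⊖-closed x x∈ with ∈⟨⟩⁻ x∈
    ... | i , refl = subst (_∈ ⟨ g ⟩) (⊖-unique inverse) (·∈⟨⟩ (n ∸ toℕ i) g)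
      where
      inverse : (n ∸ toℕ i) · g ⊕ toℕ i · g ≡ 𝟘
      inverse = begin
        (n ∸ toℕ i) · g ⊕ toℕ i · g   ≡⟨ ·-distribʳ-+ (n ∸ toℕ i) (toℕ i) g ⟨
        (n ∸ toℕ i + toℕ i) · g       ≡⟨ cong (_· g) (m∸n+n≡m (<⇒≤ (toℕ<n i))) ⟩
        n · g                         ≡⟨ n·g≡𝟘 g ⟩
        𝟘                             ∎
        where open ≡-Reasoning

  ∣H∣≢2 : ∀ {H x} → IsSubgroup n H → x ∈ H → x ≢ 𝟘 → x ⊕ x ≢ 𝟘 → ∣ H ∣ ≢ 2
  ∣H∣≢2 {x = x} (𝟘∈H , ⊕-closed , _) x∈H x≢𝟘 x⊕x≢𝟘 ∣H∣≡2 =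
    [ x⊕x≢𝟘 , x⊕x≢x x≢𝟘 ] (∣p∣≡2⇒≡⊎≡ ∣H∣≡2 𝟘∈H x∈H (x≢𝟘 ∘ sym) (⊕-closed x x x∈H x∈H))

  multiples-isSubgroup : ∀ {d} → d ∣ n → IsSubgroup n (multiples d)
  multiples-isSubgroup {d} d∣n =
      ∈-multiples⁺ (∣toℕ-mod⁺ d∣n (d ∣0))
    , (λ x y x∈ y∈ → ∈-multiples⁺ (∣toℕ-mod⁺ d∣n (∣m∣n⇒∣m+n (∈-multiples⁻ x∈) (∈-multiples⁻ y∈))))
    , (λ x x∈ → ∈-multiples⁺ (∣toℕ-mod⁺ d∣n (d∣n∸x x (∈-multiples⁻ x∈))))
    where
    d∣n∸x : ∀ x → d ∣ toℕ x → d ∣ n ∸ toℕ x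
    d∣n∸x x d∣x = ∣m+n∣m⇒∣n (subst (d ∣_) (sym (m+[n∸m]≡n (<⇒≤ (toℕ<n x)))) d∣n) d∣x

  multiples-nontrivial : ∀ {d} .{{_ : NonZero d}} → 2 * d ∣ n → Nontrivial n (multiples d)
  multiples-nontrivial {d} 2d∣n = d mod n , ∈-multiples⁺ (subst (d ∣_) (sym toℕ-d) ∣-refl) ,
    λ d≡𝟘 → ≢-nonZero⁻¹ d (trans (sym toℕ-d) (trans (cong toℕ d≡𝟘) toℕ-𝟘))
    where
    d<n : d < n
    d<n = <-≤-trans (subst (d <_) (*-comm d 2) (m<m*n d 2 (s≤s (s≤s z≤n)))) (∣⇒≤ 2d∣n)
    toℕ-d : toℕ (d mod n) ≡ d
    toℕ-d = trans (toℕ-mod d) (m<n⇒m%n≡m d<n)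

  oddMultiple⇒∈Ko : ∀ {d x} → 2 * d ∣ n → OddMultiple d (toℕ x) → InKo n (multiples d) x
  oddMultiple⇒∈Ko {d} 2d∣n (d∣x , ¬2d∣x) = ∈-multiples⁺ d∣x , λ where
    (k , k∈K , refl) → ¬2d∣x (∣toℕ-mod⁺ 2d∣n (∣-double⁺ (∈-multiples⁻ {d = d} k∈K)))

  nonZero-factor : ∀ q d → n ≡ q * d → NonZero d
  nonZero-factor q zero    n≡q*0 = contradiction (trans n≡q*0 (*-zeroʳ q)) (≢-nonZero⁻¹ n)
  nonZero-factor q (suc d) _     = _

  conclusion-via-multiples : ∀ {S H} d q .{{_ : NonZero d}} → n ≡ q * d → 2 ∣ q
    → IsSubgroup n H → Nontrivial n H
    → (∀ s g → s ∈ S → ¬ OddMultiple d (toℕ s) → g ∈ H → s ⊕ g ∈ S ⊎ OddMultiple d (toℕ (s ⊕ g)))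
    → ∣ H ∣ ≢ 2 ⊎ 4 ∣ q
    → Conclusion n S
  conclusion-via-multiples {S} {H} d q n≡qd 2∣q H-sub H-nontrivial translate last =
    H , multiples d , H-sub , H-nontrivial ,
    multiples-isSubgroup (divides q n≡qd) , multiples-nontrivial 2d∣n ,
    subst (2 ∣_) (sym ∣K∣≡q) 2∣q ,
    (λ s g s∈S s∉Ko g∈H → map₂ (oddMultiple⇒∈Ko 2d∣n) (translate s g s∈S (s∉Ko ∘ oddMultiple⇒∈Ko 2d∣n) g∈H)) ,
    map₂ (subst (4 ∣_) (sym ∣K∣≡q)) last
    where
    ∣K∣≡q : ∣ multiples {n} d ∣ ≡ q
    ∣K∣≡q = ∣multiples∣ d q n≡qd
    2d∣n : 2 * d ∣ n
    2d∣n = subst (2 * d ∣_) (sym n≡qd) (*-monoˡ-∣ d 2∣q)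

  module _ (S : Subset n) where

    wilsonC1⇒conclusion : 2 ∣ n → WilsonC1 n S → Conclusion n S
    wilsonC1⇒conclusion 2∣n (h , h≢𝟘 , 2∣h , h+Se≡Se) =
      conclusion-via-multiples 1 n (sym (*-identityʳ n)) 2∣n (⟨⟩-isSubgroup h) (h , g∈⟨g⟩ h , h≢𝟘)
        translate last
      where
      Se-closed : ∀ s → InSe n S s → InSe n S (s ⊕ h)
      Se-closed s s∈Se = subst (InSe n S) (⊕-comm h s) (proj₂ (h+Se≡Se (h ⊕ s)) (s , s∈Se , refl))
      translate : ∀ s g → s ∈ S → ¬ OddMultiple 1 (toℕ s) → g ∈ ⟨ h ⟩
        → s ⊕ g ∈ S ⊎ OddMultiple 1 (toℕ (s ⊕ g))
      translate s g s∈S ¬odd g∈⟨h⟩ with ∈⟨⟩⁻ g∈⟨h⟩ | 2 ∣? toℕ s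
      ... | j , refl | yes 2∣s = inj₁ (proj₁ (·-closed (InSe n S) Se-closed (toℕ j) (s∈S , 2∣s)))
      ... | _ | no ¬2∣s = contradiction (1∣ toℕ s , ¬2∣s) ¬odd
      last : ∣ ⟨ h ⟩ ∣ ≢ 2 ⊎ 4 ∣ n
      last with 4 ∣? n
      ... | yes 4∣n = inj₂ 4∣n
      ... | no ¬4∣n = inj₁ (∣H∣≢2 (⟨⟩-isSubgroup h) (g∈⟨g⟩ h) h≢𝟘
                        λ h⊕h≡𝟘 → ¬4∣n (subst (4 ∣_) (x⊕x≡𝟘⇒x+x≡n h≢𝟘 h⊕h≡𝟘) (∣-double⁺ 2∣h)))

    module WilsonC2'Case (4∣n : 4 ∣ n) {h : Fin n} (¬2∣h : ¬ 2 ∣ toℕ h)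
                         (2h+So≡So : TranslateEq n (h ⊕ h) (InSo n S))
                         (rule : ∀ s → s ∈ S → (4 ∣ toℕ s) ⊎ (4 ∣ toℕ s + toℕ h) → s ⊕ h ∈ S) where

      2∣n : 2 ∣ n
      2∣n = ∣-trans (divides 2 refl) 4∣n

      h≢𝟘 : h ≢ 𝟘
      h≢𝟘 = ¬∣toℕ⇒≢𝟘 ¬2∣h

      h⊕h≢𝟘 : h ⊕ h ≢ 𝟘
      h⊕h≢𝟘 = ¬∣toℕ⇒≢𝟘 (¬2∣h ∘ ∣-double⁻ ∘ ∣toℕ-mod⁻ 4∣n)

      Bad : Fin n → Set
      Bad y = OddMultiple 2 (toℕ y)

      Good : Fin n → Set
      Good y = y ∈ S ⊎ Bad y

      Step : Fin n → Set
      Step s = (s ⊕ h ∈ S × ¬ Bad (s ⊕ h)) ⊎ (Bad (s ⊕ h) × (s ⊕ h) ⊕ h ∈ S × ¬ Bad ((s ⊕ h) ⊕ h))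

      step-4∣ : ∀ s → s ∈ S → 4 ∣ toℕ s → Step s
      step-4∣ s s∈S 4∣s = inj₁ (rule s s∈S (inj₁ 4∣s) , λ (2∣s⊕h , _) →
        ¬2∣h (∣m+n∣m⇒∣n (∣toℕ-mod⁻ 2∣n 2∣s⊕h) (∣-trans (divides 2 refl) 4∣s)))

      step-odd : ∀ s → s ∈ S → ¬ 2 ∣ toℕ s → Step s
      step-odd s s∈S ¬2∣s with 4 ∣? (toℕ s + toℕ h)
      ... | yes 4∣s+h = inj₁ (rule s s∈S (inj₂ 4∣s+h) , λ (_ , ¬4∣s⊕h) → ¬4∣s⊕h (∣toℕ-mod⁺ 4∣n 4∣s+h))
      ... | no ¬4∣s+h = inj₂ ( (∣toℕ-mod⁺ 2∣n (odd+odd⇒even ¬2∣s ¬2∣h) , ¬4∣s+h ∘ ∣toℕ-mod⁻ 4∣n)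
                             , subst (_∈ S) (sym s⊕h⊕h≡) (proj₁ s⊕h⊕h∈So)
                             , λ (2∣s⊕h⊕h , _) → proj₂ s⊕h⊕h∈So (subst (λ y → 2 ∣ toℕ y) s⊕h⊕h≡ 2∣s⊕h⊕h) )
        where
        s⊕h⊕h≡ : (s ⊕ h) ⊕ h ≡ (h ⊕ h) ⊕ s
        s⊕h⊕h≡ = trans (⊕-assoc s h h) (⊕-comm s (h ⊕ h))
        s⊕h⊕h∈So : InSo n S ((h ⊕ h) ⊕ s)
        s⊕h⊕h∈So = proj₂ (2h+So≡So ((h ⊕ h) ⊕ s)) (s , (s∈S , ¬2∣s) , refl)

      step : ∀ s → s ∈ S → ¬ Bad s → Step s
      step s s∈S ¬bad with 2 ∣? toℕ s | 4 ∣? toℕ s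
      ... | no ¬2∣s | _       = step-odd s s∈S ¬2∣s
      ... | yes _   | yes 4∣s = step-4∣ s s∈S 4∣s
      ... | yes 2∣s | no ¬4∣s = contradiction (2∣s , ¬4∣s) ¬bad

      reach : ∀ k s → s ∈ S → ¬ Bad s → Good (s ⊕ k · h) × Good (s ⊕ suc k · h)
      reach zero s s∈S ¬bad =
          inj₁ (subst (_∈ S) (sym (⊕-identityʳ s)) s∈S)
        , subst Good (sym (trans (⊕-·-suc s 0 h) (⊕-identityʳ (s ⊕ h))))
                ([ inj₁ ∘ proj₁ , inj₂ ∘ proj₁ ] (step s s∈S ¬bad))
      reach (suc k) s s∈S ¬bad =
        proj₂ (reach k s s∈S ¬bad) , subst Good (sym (⊕-·-suc s (suc k) h)) (next (step s s∈S ¬bad))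
        where
        next : Step s → Good ((s ⊕ h) ⊕ suc k · h)
        next (inj₁ (s⊕h∈S , ¬bad₁)) = proj₂ (reach k (s ⊕ h) s⊕h∈S ¬bad₁)
        next (inj₂ (_ , s⊕h⊕h∈S , ¬bad₂)) =
          subst Good (sym (⊕-·-suc (s ⊕ h) k h)) (proj₁ (reach k ((s ⊕ h) ⊕ h) s⊕h⊕h∈S ¬bad₂))

      translate : ∀ s g → s ∈ S → ¬ Bad s → g ∈ ⟨ h ⟩ → Good (s ⊕ g)
      translate s g s∈S ¬bad g∈⟨h⟩ with ∈⟨⟩⁻ g∈⟨h⟩
      ... | j , refl = proj₁ (reach (toℕ j) s s∈S ¬bad)

    wilsonC2'⇒conclusion : WilsonC2' n S → Conclusion n S
    wilsonC2'⇒conclusion (4∣n , h , ¬2∣h , 2h+So≡So , rule) =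
      conclusion-via-multiples 2 (c * 2) n≡c*2*2 (divides c refl) (⟨⟩-isSubgroup h) (h , g∈⟨g⟩ h , h≢𝟘)
        translate (inj₁ (∣H∣≢2 (⟨⟩-isSubgroup h) (g∈⟨g⟩ h) h≢𝟘 h⊕h≢𝟘))
      where
      open WilsonC2'Case 4∣n ¬2∣h 2h+So≡So rule
      c : ℕ
      c = quotient 4∣n
      n≡c*2*2 : n ≡ c * 2 * 2
      n≡c*2*2 = trans (_∣_.equality 4∣n) (sym (*-assoc c 2 2))

    module WilsonC3'Case {H : Subset n} (H-sub : IsSubgroup n H) {r₀ : Fin n} (r₀∈R : InR n S H r₀)
                         {d q : ℕ} (n≡qd : n ≡ q * d) (2∣q : 2 ∣ q)
                         (R-odd : ∀ r → InR n S H r → ∃[ a ] (toℕ r ≡ a * d × ¬ 2 ∣ a))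
                         (H-cases : ¬ (∀ x → x ∈ H → d ∣ toℕ x) ⊎ (∀ x → x ∈ H → 2 * d ∣ toℕ x)) where

      instance
        d≢0 : NonZero d
        d≢0 = nonZero-factor q d n≡qd

      R⇒oddMultiple : ∀ {r} → InR n S H r → OddMultiple d (toℕ r)
      R⇒oddMultiple r∈R with R-odd _ r∈R
      ... | a , r≡ad , ¬2∣a = divides a r≡ad , λ 2d∣r → ¬2∣a (*-cancelʳ-∣ d (subst (2 * d ∣_) r≡ad 2d∣r))

      translate : ∀ s g → s ∈ S → ¬ OddMultiple d (toℕ s) → g ∈ H → s ⊕ g ∈ S ⊎ OddMultiple d (toℕ (s ⊕ g))
      translate s g s∈S ¬odd g∈H with s ⊕ g ∈? S
      ... | yes s⊕g∈S = inj₁ s⊕g∈S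
      ... | no s⊕g∉S  = contradiction (R⇒oddMultiple (s∈S , λ s+H⊆S → s⊕g∉S (s+H⊆S g g∈H))) ¬odd

      escape : ∃[ x ] ¬ (x ∈ H → r₀ ⊕ x ∈ S)
      escape = ¬∀⟶∃¬ n (λ y → y ∈ H → r₀ ⊕ y ∈ S) (λ y → y ∈? H →-dec r₀ ⊕ y ∈? S) (proj₂ r₀∈R)

      x : Fin n
      x = proj₁ escape

      x∈H : x ∈ H
      x∈H with x ∈? H
      ... | yes x∈H = x∈H
      ... | no x∉H  = contradiction (λ x∈H → contradiction x∈H x∉H) (proj₂ escape)

      x≢𝟘 : x ≢ 𝟘
      x≢𝟘 x≡𝟘 = proj₂ escape λ _ →
        subst (λ y → r₀ ⊕ y ∈ S) (sym x≡𝟘) (subst (_∈ S) (sym (⊕-identityʳ r₀)) (proj₁ r₀∈R))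

      x+x≡qd : ∣ H ∣ ≡ 2 → toℕ x + toℕ x ≡ q * d
      x+x≡qd ∣H∣≡2 with x ⊕ x ≟ 𝟘
      ... | yes x⊕x≡𝟘 = trans (x⊕x≡𝟘⇒x+x≡n x≢𝟘 x⊕x≡𝟘) n≡qd
      ... | no x⊕x≢𝟘  = contradiction ∣H∣≡2 (∣H∣≢2 H-sub x∈H x≢𝟘 x⊕x≢𝟘)

      H⊆multiples : ∣ H ∣ ≡ 2 → ∀ y → y ∈ H → d ∣ toℕ y
      H⊆multiples ∣H∣≡2 y y∈H with ∣p∣≡2⇒≡⊎≡ ∣H∣≡2 (proj₁ H-sub) x∈H (x≢𝟘 ∘ sym) y∈H
      ... | inj₁ refl = ∣toℕ-𝟘 d
      ... | inj₂ refl = ∣-double⁻ (subst (2 * d ∣_) (sym (x+x≡qd ∣H∣≡2)) (*-monoˡ-∣ d 2∣q))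

      ∣H∣≡2⇒4∣q : ∣ H ∣ ≡ 2 → 4 ∣ q
      ∣H∣≡2⇒4∣q ∣H∣≡2 = [ (λ H⊈multiples → contradiction (H⊆multiples ∣H∣≡2) H⊈multiples)
                        , (λ H⊆2multiples → *-cancelʳ-∣ d (subst₂ _∣_ (sym (*-assoc 2 2 d)) (x+x≡qd ∣H∣≡2)
                                                             (∣-double⁺ (H⊆2multiples x x∈H))))
                        ] H-cases

      ∣H∣≢2⊎4∣q : ∣ H ∣ ≢ 2 ⊎ 4 ∣ q
      ∣H∣≢2⊎4∣q with 4 ∣? q
      ... | yes 4∣q = inj₂ 4∣q
      ... | no ¬4∣q = inj₁ (¬4∣q ∘ ∣H∣≡2⇒4∣q)

    wilsonC3'⇒conclusion : WilsonC3' n S → Conclusion n S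
    wilsonC3'⇒conclusion (H , H-sub , r₀ , r₀∈R , d , _ , q , (n≡qd , 2∣q) , R-odd , H-cases) =
      conclusion-via-multiples d q n≡qd 2∣q H-sub (x , x∈H , x≢𝟘) translate ∣H∣≢2⊎4∣q
      where open WilsonC3'Case H-sub r₀∈R n≡qd 2∣q R-odd H-cases

proposition3p4 : (n : ℕ) .{{_ : NonZero n}} → 2 ∣ n → (S : Subset n) → ConnectionSet n S
    → (WilsonC1 n S ⊎ WilsonC2' n S ⊎ WilsonC3' n S) → Conclusion n S
proposition3p4 n 2∣n S _ =
  [ wilsonC1⇒conclusion n S 2∣n , [ wilsonC2'⇒conclusion n S , wilsonC3'⇒conclusion n S ] ]
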